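{- For all formulas $\varphi,\psi,\gamma$, writing $\alpha\to\beta$ for $\neg\alpha\lor\beta$, the following hold in the system $\mathsf{R}'_{\mathrm{BK}}$: (a) $\varphi\lor\psi\vdash_{\mathsf{R}'_{\mathrm{BK}}}\varphi\to(\varphi\lor\psi)$; (b) $\varphi\to\psi,\varphi\vdash_{\mathsf{R}'_{\mathrm{BK}}}\psi$; (c) $(\varphi\lor\psi)\lor\gamma\vdash_{\mathsf{R}'_{\mathrm{BK}}}\varphi\lor(\psi\lor\gamma)$; (d) $\varphi\to\gamma,\psi\to\gamma\vdash_{\mathsf{R}'_{\mathrm{BK}}}(\varphi\lor\psi)\to\gamma$.
   Context: Formulas are built from a countably infinite set of variables with binary $\land,\lor$ and unary $\neg$. Set-Fmla Hilbert systems: rule schemas $\gamma_1,\dots,\gamma_m/\varphi$ with all substitution instances; $\Gamma\vdash_{\mathsf R}\varphi$ iff some finite sequence ending in $\varphi$ has each member in $\Gamma$ or the conclusion of a rule instance whose premises occur earlier. The $\lor$-lifted version of a rule $\gamma_1,\dots,\gamma_m/\varphi$ is $s\lor\gamma_1,\dots,s\lor\gamma_m/s\lor\varphi$ with $s$ a variable not occurring in the rule. $\mathsf{R}'_{\mathrm{BK}}$ has rule schemas ($p,q,r$ distinct): (1$\star$) $p,\neg p/q$; (2) $p/\neg\neg p$; (3) $\neg\neg p/p$; (4) $p,q/p\land q$; (5) $\neg p,\neg q/\neg(p\land q)$; (6) $\neg p,q/\neg(p\land q)$; (7) $p,\neg q/\neg(p\land q)$; (8$\star$) $\neg(p\land q)/\neg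 p\lor p$; (9$\star$) $\neg(p\land q)/\neg q\lor q$; (10) $p\land q/p$; (11) $p\land q/q$; (12) $\neg p,\neg q/\neg(p\lor q)$; (13) $\neg(p\lor q)/\neg p$; (14) $\neg(p\lor q)/\neg q$; (15$\star$) $p\lor q/p\lor\neg p$; (16$\star$) $p\lor q/q\lor\neg q$; (17) $\neg p,q/p\lor q$; (18) $p,\neg q/p\lor q$; (19) $p,q/p\lor q$; (20) $p\lor q,\neg p/q$; (21) $p\lor(q\lor r)/(p\lor q)\lor r$; (22) $p\lor p/p$; (23) $p\lor q/q\lor p$; (24) $p\lor q,r/\neg p\lor r$; plus the $\lor$-lifted versions of all these except (1$\star$). -}

module Defs where

open import Data.Nat using (ℕ)
open import Data.List using (List; []; _∷_; _++_; map)
open import Data.List.Membership.Propositional using (_∈_)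
open import Data.List.Relation.Unary.All using (All)
open import Data.Product using (Σ; _×_)
open import Data.Sum using (_⊎_)
open import Relation.Binary.PropositionalEquality using (_≡_)

infixr 6 _∧_
infixr 5 _∨_
infix 7 ¬_

data Fmla : Set where
  var : ℕ → Fmla
  _∧_ : Fmla → Fmla → Fmla
  _∨_ : Fmla → Fmla → Fmla
  ¬_  : Fmla → Fmla

_⇒_ : Fmla → Fmla → Fmla
α ⇒ β = ¬ α ∨ β
infixr 4 _⇒_

sub : (ℕ → Fmla) → Fmla → Fmla
sub σ (var n) = σ n
sub σ (φ ∧ ψ) = sub σ φ ∧ sub σ ψ
sub σ (φ ∨ ψ) = sub σ φ ∨ sub σ ψ
sub σ (¬ φ)   = ¬ sub σ φ

record Rule : Set where
  constructor _/_
  field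
    premises   : List Fmla
    conclusion : Fmla
open Rule public

p q r s : Fmla
p = var 0
q = var 1
r = var 2
s = var 3

-- ∨-lifted version of a rule; s = var 3 does not occur in any base rule
lift : Rule → Rule
lift (γs / φ) = map (s ∨_) γs / (s ∨ φ)

rule1 : Rule
rule1 = (p ∷ ¬ p ∷ []) / q

rules2-24 : List Rule
rules2-24 =
    ((p ∷ []) / (¬ ¬ p))
  ∷ ((¬ ¬ p ∷ []) / p)
  ∷ ((p ∷ q ∷ []) / (p ∧ q))
  ∷ ((¬ p ∷ ¬ q ∷ []) / (¬ (p ∧ q)))
  ∷ ((¬ p ∷ q ∷ []) / (¬ (p ∧ q)))
  ∷ ((p ∷ ¬ q ∷ []) / (¬ (p ∧ q)))
  ∷ ((¬ (p ∧ q) ∷ []) / (¬ p ∨ p))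
  ∷ ((¬ (p ∧ q) ∷ []) / (¬ q ∨ q))
  ∷ (((p ∧ q) ∷ []) / p)
  ∷ (((p ∧ q) ∷ []) / q)
  ∷ ((¬ p ∷ ¬ q ∷ []) / (¬ (p ∨ q)))
  ∷ ((¬ (p ∨ q) ∷ []) / (¬ p))
  ∷ ((¬ (p ∨ q) ∷ []) / (¬ q))
  ∷ (((p ∨ q) ∷ []) / (p ∨ ¬ p))
  ∷ (((p ∨ q) ∷ []) / (q ∨ ¬ q))
  ∷ ((¬ p ∷ q ∷ []) / (p ∨ q))
  ∷ ((p ∷ ¬ q ∷ []) / (p ∨ q))
  ∷ ((p ∷ q ∷ []) / (p ∨ q))
  ∷ (((p ∨ q) ∷ ¬ p ∷ []) / q)
  ∷ (((p ∨ (q ∨ r)) ∷ []) / ((p ∨ q) ∨ r))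
  ∷ (((p ∨ p) ∷ []) / p)
  ∷ (((p ∨ q) ∷ []) / (q ∨ p))
  ∷ (((p ∨ q) ∷ r ∷ []) / (¬ p ∨ r))
  ∷ []

R'BK : List Rule
R'BK = rule1 ∷ rules2-24 ++ map lift rules2-24

-- A derivation is a finite sequence, stored in reverse (head = latest item);
-- each item is in Γ or the conclusion of a rule instance whose premises occur earlier.
module Derivability (R : List Rule) (Γ : Fmla → Set) where

  Justified : List Fmla → Fmla → Set
  Justified earlier φ =
    Γ φ ⊎ Σ Rule (λ ρ → ρ ∈ R × Σ (ℕ → Fmla) (λ σ →
      All (λ γ → sub σ γ ∈ earlier) (premises ρ) × sub σ (conclusion ρ) ≡ φ))

  data ValidSeq : List Fmla → Set where
    []   : ValidSeq []
    step : ∀ {xs φ} → ValidSeq xs → Justified xs φ → ValidSeq (φ ∷ xs)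

_⊢[_]_ : (Fmla → Set) → List Rule → Fmla → Set
Γ ⊢[ R ] φ = Σ (List Fmla) (λ xs → Derivability.ValidSeq R Γ (φ ∷ xs))

⟦_⟧ : List Fmla → Fmla → Set
⟦ Γ ⟧ φ = φ ∈ Γ

-- Derivability is closed under the rules of the system: valid sequences can be
-- concatenated, so derivations of all premises of a rule instance combine into
-- one derivation of its conclusion.  Each item then becomes a short chain of
-- derived rules: (b) is disjunctive syllogism after double-negation
-- introduction, (c) reassociates by alternating commutation (23) with (21), and
-- (d) is the ∨-lifted rule (12) with the common consequent γ as side formula.

module Submission where

open import Defs
open import Data.Nat using (ℕ)
open import Data.Fin using (Fin; #_)
open import Data.List using (List; []; _∷_; _++_; lookup)
open import Data.List.Membership.Propositional using (_∈_)
open import Data.List.Membership.Propositional.Properties using (∈-++⁺ˡ; ∈-++⁺ʳ; ∈-map⁺; ∈-lookup)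
open import Data.List.Relation.Unary.All as All using (All; []; _∷_)
open import Data.List.Relation.Unary.Any using (here; there)
open import Data.Product using (Σ; _×_; _,_)
open import Data.Sum using (inj₁; inj₂)
open import Function using (_∘_)
open import Relation.Binary.PropositionalEquality using (refl)

module _ {R : List Rule} {Γ : Fmla → Set} where
  open Derivability R Γ

  justified-++ : ∀ {xs ys φ} → Justified xs φ → Justified (xs ++ ys) φ
  justified-++ (inj₁ φ∈Γ) = inj₁ φ∈Γ
  justified-++ (inj₂ (ρ , ρ∈R , σ , premises∈ , eq)) =
    inj₂ (ρ , ρ∈R , σ , All.map ∈-++⁺ˡ premises∈ , eq)

  validSeq-++ : ∀ {xs ys} → ValidSeq xs → ValidSeq ys → ValidSeq (xs ++ ys)
  validSeq-++ []            vys = vys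
  validSeq-++ (step vxs js) vys = step (validSeq-++ vxs vys) (justified-++ js)

  validSeq-containing : {f : Fmla → Fmla} {γs : List Fmla} →
    All (λ γ → Γ ⊢[ R ] f γ) γs →
    Σ (List Fmla) λ zs → ValidSeq zs × All (λ γ → f γ ∈ zs) γs
  validSeq-containing [] = [] , [] , []
  validSeq-containing {f} {γ ∷ _} ((xs , vγ) ∷ ds) with validSeq-containing ds
  ... | zs , vzs , γs∈ =
    (f γ ∷ xs) ++ zs , validSeq-++ vγ vzs , here refl ∷ All.map (∈-++⁺ʳ (f γ ∷ xs)) γs∈

  ⊢-assumption : ∀ {φ} → Γ φ → Γ ⊢[ R ] φ
  ⊢-assumption φ∈Γ = [] , step [] (inj₁ φ∈Γ)

  ⊢-rule : ∀ {ρ} → ρ ∈ R → (σ : ℕ → Fmla) →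
    All (λ γ → Γ ⊢[ R ] sub σ γ) (premises ρ) → Γ ⊢[ R ] sub σ (conclusion ρ)
  ⊢-rule ρ∈R σ ds with validSeq-containing ds
  ... | zs , vzs , premises∈ = zs , step vzs (inj₂ (_ , ρ∈R , σ , premises∈ , refl))

-- Rule (n) of the paper, for 2 ≤ n ≤ 24, is  lookup rules2-24 (# (n - 2)).
base-rule∈R'BK : (i : Fin 23) → lookup rules2-24 i ∈ R'BK
base-rule∈R'BK i = there (∈-++⁺ˡ (∈-lookup {xs = rules2-24} i))

lifted-rule∈R'BK : (i : Fin 23) → lift (lookup rules2-24 i) ∈ R'BK
lifted-rule∈R'BK i = there (∈-++⁺ʳ rules2-24 (∈-map⁺ lift (∈-lookup {xs = rules2-24} i)))

assign : Fmla → Fmla → Fmla → Fmla → ℕ → Fmla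
assign a b c d 0 = a
assign a b c d 1 = b
assign a b c d 2 = c
assign a b c d _ = d

module _ {Γ : Fmla → Set} where
  private
    infix 1 ⊢_
    ⊢_ : Fmla → Set
    ⊢ φ = Γ ⊢[ R'BK ] φ

  ¬¬-intro : ∀ {φ} → ⊢ φ → ⊢ ¬ ¬ φ
  ¬¬-intro {φ} d = ⊢-rule (base-rule∈R'BK (# 0)) (assign φ φ φ φ) (d ∷ [])

  disjunctive-syllogism : ∀ {φ ψ} → ⊢ φ ∨ ψ → ⊢ ¬ φ → ⊢ ψ
  disjunctive-syllogism {φ} {ψ} d e =
    ⊢-rule (base-rule∈R'BK (# 18)) (assign φ ψ φ φ) (d ∷ e ∷ [])

  ∨-assocˡ : ∀ {φ ψ χ} → ⊢ φ ∨ (ψ ∨ χ) → ⊢ (φ ∨ ψ) ∨ χ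
  ∨-assocˡ {φ} {ψ} {χ} d = ⊢-rule (base-rule∈R'BK (# 19)) (assign φ ψ χ φ) (d ∷ [])

  ∨-comm : ∀ {φ ψ} → ⊢ φ ∨ ψ → ⊢ ψ ∨ φ
  ∨-comm {φ} {ψ} d = ⊢-rule (base-rule∈R'BK (# 21)) (assign φ ψ φ φ) (d ∷ [])

  ⇒-intro : ∀ {φ ψ χ} → ⊢ φ ∨ ψ → ⊢ χ → ⊢ φ ⇒ χ
  ⇒-intro {φ} {ψ} {χ} d e = ⊢-rule (base-rule∈R'BK (# 22)) (assign φ ψ χ φ) (d ∷ e ∷ [])

  ∨-¬∨-intro : ∀ {φ ψ χ} → ⊢ χ ∨ ¬ φ → ⊢ χ ∨ ¬ ψ → ⊢ χ ∨ ¬ (φ ∨ ψ)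
  ∨-¬∨-intro {φ} {ψ} {χ} d e =
    ⊢-rule (lifted-rule∈R'BK (# 10)) (assign φ ψ φ χ) (d ∷ e ∷ [])

  ∨-assocʳ : ∀ {φ ψ χ} → ⊢ (φ ∨ ψ) ∨ χ → ⊢ φ ∨ (ψ ∨ χ)
  ∨-assocʳ = ∨-comm ∘ ∨-assocˡ ∘ ∨-comm ∘ ∨-assocˡ ∘ ∨-comm

  modus-ponens : ∀ {φ ψ} → ⊢ φ ⇒ ψ → ⊢ φ → ⊢ ψ
  modus-ponens d e = disjunctive-syllogism d (¬¬-intro e)

  ⇒-∨-elim : ∀ {φ ψ χ} → ⊢ φ ⇒ χ → ⊢ ψ ⇒ χ → ⊢ (φ ∨ ψ) ⇒ χ
  ⇒-∨-elim d e = ∨-comm (∨-¬∨-intro (∨-comm d) (∨-comm e))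

proposition5 : (φ ψ γ : Fmla) →
    (⟦ (φ ∨ ψ) ∷ [] ⟧ ⊢[ R'BK ] (φ ⇒ (φ ∨ ψ)))
    × (⟦ (φ ⇒ ψ) ∷ φ ∷ [] ⟧ ⊢[ R'BK ] ψ)
    × (⟦ ((φ ∨ ψ) ∨ γ) ∷ [] ⟧ ⊢[ R'BK ] (φ ∨ (ψ ∨ γ)))
    × (⟦ (φ ⇒ γ) ∷ (ψ ⇒ γ) ∷ [] ⟧ ⊢[ R'BK ] ((φ ∨ ψ) ⇒ γ))
proposition5 φ ψ γ =
    ⇒-intro first first
  , modus-ponens first second
  , ∨-assocʳ first
  , ⇒-∨-elim first second
  where
  first : ∀ {α β} → ⟦ α ∷ β ⟧ ⊢[ R'BK ] α
  first = ⊢-assumption (here refl)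

  second : ∀ {α β γs} → ⟦ α ∷ β ∷ γs ⟧ ⊢[ R'BK ] β
  second = ⊢-assumption (there (here refl))
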